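{- Let $\eta,\delta,M>1$ and $f\ge 1$ be integers with $\gcd(\eta,\delta)=1$, such that there exist integers $a\ge 1$ and $s$ with $\sum_{i=0}^{M-1}(a+i)^2=s^2$, and such that $$M=\frac{\delta^2(3f^2-1)}{3(\eta+\delta)^2+\delta^2}.$$ Then: (i) if $\delta\equiv 1$ or $5\pmod 6$, then $M\equiv 0\pmod{\delta^2}$; if $\delta\equiv 0\pmod 6$, then $M\equiv 0\pmod{\delta^2/3}$; (ii) if $f\equiv 1\pmod 2$, then $M\equiv 0\pmod{2\delta^2}$ when $\delta\equiv 1$ or $5\pmod 6$, and $M\equiv 0\pmod{2\delta^2/3}$ when $\delta\equiv 0\pmod 6$.
   Context: Setting of the paper: for a positive rational $\mu=\eta/\delta$ in lowest terms, two positive integers $a_1,a_2$ form a pair for a common number of terms $M$ if $a_1+a_2=\mu M+1$ and $a_2-a_1=f$; when $M=\delta^2(3f^2-1)/(3(\eta+\delta)^2+\delta^2)$ the sums $\sum_{i=0}^{M-1}(a_j+i)^2$ are perfect squares. Thus $M$ is the number of terms of a sum of consecutive squares equal to a square and $f$ is the difference of first terms. -}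

module Defs where

open import Data.Nat using (ℕ; zero; suc; _+_; _*_; _^_)
open import Data.Integer as ℤ using (ℤ)

sumSq : ℕ → ℕ → ℕ
sumSq a zero = 0
sumSq a (suc m) = sumSq a m + (a + m) ^ 2

{-# OPTIONS --safe #-}
-- Put P = η + δ and D = 3P² + δ², so that M·D = δ²(3f² − 1) with P coprime to δ.
-- If 3 ∤ δ, then D is coprime to δ and hence δ² ∣ M. If 3 ∣ δ, then
-- D = 3(P² + δ²/3) and δ ∣ δ²/3, so P² + δ²/3 is coprime to δ and δ²/3 ∣ M.
-- For odd f, 3f² − 1 is twice an odd number, and the extra factor 2 goes into M
-- because the relevant cofactor of M is odd: when 6 ∣ δ since P is then odd,
-- and when δ is odd since an odd P would force 4 ∣ D ∣ δ²(3f² − 1).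
module Submission where

open import Defs
open import Data.Nat using (ℕ; zero; suc; _+_; _*_; _∸_; _^_; _≤_; _<_; _%_; _/_; NonZero)
open import Data.Nat.Divisibility
  using (_∣_; divides; ∣-refl; ∣-trans; ∣m+n∣m⇒∣n; ∣m⇒∣m*n; ∣n⇒∣m*n; m∣m*n; *-monoʳ-∣;
         *-cancelˡ-∣; ∣1⇒≡1; %-presˡ-∣; m%n≡0⇒n∣m; module ∣-Reasoning)
open import Data.Nat.DivMod using (m*n/n≡m; m/n*n≡m)
open import Data.Nat.GCD using (gcd)
open import Data.Nat.Coprimality as Coprime
  using (Coprime; coprime?; coprime-divisor; coprime-+; 1-coprimeTo; gcd≡1⇒coprime)
open import Data.Nat.Properties using (+-comm; *-comm; *-assoc; *-suc; *-identityʳ; *-cancelʳ-≡; m+n∸m≡n)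
open import Data.Nat.Solver using (module +-*-Solver)
open import Data.Integer as ℤ using (ℤ; +_)
open import Data.Product using (∃; ∃-syntax; _×_; _,_)
open import Data.Sum using (_⊎_; inj₁; inj₂)
open import Data.Empty using (⊥-elim)
open import Relation.Nullary using (¬_; contradiction)
open import Relation.Nullary.Decidable using (toWitness)
open import Relation.Binary.PropositionalEquality
  using (_≡_; refl; sym; trans; cong; subst; module ≡-Reasoning)

open +-*-Solver using (solve; _:=_; _:+_; _:*_; _:^_; con)

private
  variable
    m n o r : ℕ

coprime-∣ʳ : Coprime m n → o ∣ n → Coprime m o
coprime-∣ʳ m⊥n o∣n (d∣m , d∣o) = m⊥n (d∣m , ∣-trans d∣o o∣n)

coprime-∣ˡ : Coprime m n → o ∣ m → Coprime o n
coprime-∣ˡ m⊥n o∣m = Coprime.sym (coprime-∣ʳ (Coprime.sym m⊥n) o∣m)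

coprime-*ˡ : Coprime m o → Coprime n o → Coprime (m * n) o
coprime-*ˡ m⊥o n⊥o (d∣mn , d∣o) =
  n⊥o (coprime-divisor (Coprime.sym (coprime-∣ʳ m⊥o d∣o)) d∣mn , d∣o)

coprime-^ˡ : ∀ k → Coprime m n → Coprime (m ^ k) n
coprime-^ˡ {n = n} zero    _   = 1-coprimeTo n
coprime-^ˡ         (suc k) m⊥n = coprime-*ˡ m⊥n (coprime-^ˡ k m⊥n)

coprime-+-∣ : Coprime m o → o ∣ n → Coprime (m + n) o
coprime-+-∣ {m} {n = n} m⊥o o∣n {d} (d∣m+n , d∣o) =
  m⊥o (∣m+n∣m⇒∣n (subst (d ∣_) (+-comm m n) d∣m+n) (∣-trans d∣o o∣n) , d∣o)

coprime-% : .{{_ : NonZero n}} → m % n ≡ r → Coprime n r → Coprime n m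
coprime-% refl n⊥m%n (d∣n , d∣m) = n⊥m%n (d∣n , %-presˡ-∣ d∣m d∣n)

coprime-divisorʳ : Coprime m n → m ∣ o * n → m ∣ o
coprime-divisorʳ {m} {n} {o} m⊥n m∣on = coprime-divisor m⊥n (subst (m ∣_) (*-comm o n) m∣on)

coprime-6 : n % 6 ≡ 1 ⊎ n % 6 ≡ 5 → Coprime 6 n
coprime-6 (inj₁ n%6≡1) = coprime-% n%6≡1 (toWitness {a? = coprime? 6 1} _)
coprime-6 (inj₂ n%6≡5) = coprime-% n%6≡5 (toWitness {a? = coprime? 6 5} _)

2*m∣m*[2*n] : ∀ m n → 2 * m ∣ m * (2 * n)
2*m∣m*[2*n] m n = begin
  2 * m        ≡⟨ *-comm 2 m ⟩
  m * 2        ∣⟨ *-monoʳ-∣ m (m∣m*n n) ⟩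
  m * (2 * n)  ∎
  where open ∣-Reasoning

even-or-odd : ∀ n → ∃[ p ] (n ≡ 2 * p ⊎ n ≡ 1 + 2 * p)
even-or-odd zero = 0 , inj₁ refl
even-or-odd (suc n) with even-or-odd n
... | p , inj₁ n≡2p   = p , inj₂ (cong suc n≡2p)
... | p , inj₂ n≡1+2p = suc p , inj₁ (trans (cong suc n≡1+2p) (sym (*-suc 2 p)))

coprime-2-odd : ∀ p → Coprime 2 (1 + 2 * p)
coprime-2-odd p {d} (d∣2 , d∣1+2p) =
  ∣1⇒≡1 (∣m+n∣m⇒∣n (subst (d ∣_) (+-comm 1 (2 * p)) d∣1+2p) (∣m⇒∣m*n p d∣2))

coprime-2⇒odd : Coprime 2 n → ∃[ p ] n ≡ 1 + 2 * p
coprime-2⇒odd {n} 2⊥n with even-or-odd n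
... | p , inj₂ n≡1+2p = p , n≡1+2p
... | p , inj₁ n≡2p   = contradiction (2⊥n (∣-refl , subst (2 ∣_) (sym n≡2p) (m∣m*n p))) λ ()

¬4∣2*odd : Coprime 2 m → ¬ 4 ∣ 2 * m
¬4∣2*odd 2⊥m 4∣2m = contradiction (2⊥m (∣-refl , *-cancelˡ-∣ 2 4∣2m)) λ ()

odd⇒3n²∸1≡2*odd : Coprime 2 n → ∃[ m ] (3 * n ^ 2 ∸ 1 ≡ 2 * m × Coprime 2 m)
odd⇒3n²∸1≡2*odd 2⊥n with coprime-2⇒odd 2⊥n
... | p , refl = 1 + 2 * q , 3n²∸1≡2*[1+2q] , coprime-2-odd q
  where
  q : ℕ
  q = 3 * (p * p + p)
  3n²∸1≡2*[1+2q] : 3 * (1 + 2 * p) ^ 2 ∸ 1 ≡ 2 * (1 + 2 * q)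
  3n²∸1≡2*[1+2q] = begin
    3 * (1 + 2 * p) ^ 2 ∸ 1  ≡⟨ cong (_∸ 1) (expand p) ⟩
    1 + 2 * (1 + 2 * q) ∸ 1  ≡⟨ m+n∸m≡n 1 _ ⟩
    2 * (1 + 2 * q)          ∎
    where
    open ≡-Reasoning
    expand : ∀ p → 3 * (1 + 2 * p) ^ 2 ≡ 1 + 2 * (1 + 2 * (3 * (p * p + p)))
    expand = solve 1 (λ p → con 3 :* (con 1 :+ con 2 :* p) :^ 2
                          := con 1 :+ con 2 :* (con 1 :+ con 2 :* (con 3 :* (p :* p :+ p)))) refl

odd⊎4∣3m²+n² : Coprime 2 n → ∀ m → Coprime 2 (3 * m ^ 2 + n ^ 2) ⊎ 4 ∣ 3 * m ^ 2 + n ^ 2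
odd⊎4∣3m²+n² 2⊥n m with coprime-2⇒odd 2⊥n | even-or-odd m
... | e , refl | p , inj₁ refl = inj₁ (subst (Coprime 2) (sym (expand p e)) (coprime-2-odd (6 * (p * p) + 2 * (e * e + e))))
  where
  expand : ∀ p e → 3 * (2 * p) ^ 2 + (1 + 2 * e) ^ 2 ≡ 1 + 2 * (6 * (p * p) + 2 * (e * e + e))
  expand = solve 2 (λ p e → con 3 :* (con 2 :* p) :^ 2 :+ (con 1 :+ con 2 :* e) :^ 2
                          := con 1 :+ con 2 :* (con 6 :* (p :* p) :+ con 2 :* (e :* e :+ e))) refl
... | e , refl | p , inj₂ refl = inj₂ (divides (1 + 3 * (p * p + p) + (e * e + e)) (expand p e))
  where
  expand : ∀ p e → 3 * (1 + 2 * p) ^ 2 + (1 + 2 * e) ^ 2 ≡ (1 + 3 * (p * p + p) + (e * e + e)) * 4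
  expand = solve 2 (λ p e → con 3 :* (con 1 :+ con 2 :* p) :^ 2 :+ (con 1 :+ con 2 :* e) :^ 2
                          := (con 1 :+ con 3 :* (p :* p :+ p) :+ (e :* e :+ e)) :* con 4) refl

module _ {P δ M X : ℕ} (P⊥δ : Coprime P δ) (MD≡δ²X : M * (3 * P ^ 2 + δ ^ 2) ≡ δ ^ 2 * X) where

  private
    D : ℕ
    D = 3 * P ^ 2 + δ ^ 2

    δ²⊥D : Coprime 3 δ → Coprime (δ ^ 2) D
    δ²⊥D 3⊥δ = coprime-^ˡ 2 (Coprime.sym D⊥δ)
      where
      D⊥δ : Coprime D δ
      D⊥δ = coprime-+-∣ (coprime-*ˡ 3⊥δ (coprime-^ˡ 2 P⊥δ)) (m∣m*n (δ ^ 1))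

  δ²∣M : Coprime 3 δ → δ ^ 2 ∣ M
  δ²∣M 3⊥δ = coprime-divisorʳ (δ²⊥D 3⊥δ) (subst (δ ^ 2 ∣_) (sym MD≡δ²X) (m∣m*n X))

  2δ²∣M : Coprime 2 δ → Coprime 3 δ → X ≡ 2 * m → Coprime 2 m → 2 * δ ^ 2 ∣ M
  2δ²∣M {m} 2⊥δ 3⊥δ X≡2m 2⊥m with odd⊎4∣3m²+n² 2⊥δ P
  ... | inj₁ 2⊥D = coprime-divisorʳ (coprime-*ˡ 2⊥D (δ²⊥D 3⊥δ)) 2δ²∣MD
    where
    2δ²∣MD : 2 * δ ^ 2 ∣ M * D
    2δ²∣MD = subst (2 * δ ^ 2 ∣_) (sym (trans MD≡δ²X (cong (δ ^ 2 *_) X≡2m))) (2*m∣m*[2*n] (δ ^ 2) m)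
  ... | inj₂ 4∣D = ⊥-elim (¬4∣2*odd 2⊥m (subst (4 ∣_) X≡2m 4∣X))
    where
    4⊥δ² : Coprime 4 (δ ^ 2)
    4⊥δ² = Coprime.sym (coprime-^ˡ 2 (Coprime.sym (coprime-^ˡ 2 2⊥δ)))
    4∣X : 4 ∣ X
    4∣X = coprime-divisor 4⊥δ² (subst (4 ∣_) MD≡δ²X (∣n⇒∣m*n M 4∣D))

  module _ (3∣δ : 3 ∣ δ) where

    private
      k : ℕ
      k = δ * (δ / 3)

      δ∣k : δ ∣ k
      δ∣k = m∣m*n (δ / 3)

      δ²≡k*3 : δ ^ 2 ≡ k * 3
      δ²≡k*3 = begin
        δ * (δ * 1)      ≡⟨ cong (δ *_) (*-identityʳ δ) ⟩
        δ * δ            ≡⟨ cong (δ *_) (sym (m/n*n≡m 3∣δ)) ⟩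
        δ * (δ / 3 * 3)  ≡⟨ sym (*-assoc δ (δ / 3) 3) ⟩
        k * 3            ∎
        where open ≡-Reasoning

      D′ : ℕ
      D′ = P ^ 2 + k

      MD′≡kX : M * D′ ≡ k * X
      MD′≡kX = *-cancelʳ-≡ (M * D′) (k * X) 3 (begin
        M * D′ * 3                ≡⟨ factor-3 M P k ⟩
        M * (3 * P ^ 2 + k * 3)   ≡⟨ cong (λ x → M * (3 * P ^ 2 + x)) δ²≡k*3 ⟨
        M * D                     ≡⟨ MD≡δ²X ⟩
        δ ^ 2 * X                 ≡⟨ cong (_* X) δ²≡k*3 ⟩
        k * 3 * X                 ≡⟨ swap k X ⟩
        k * X * 3                 ∎)
        where
        open ≡-Reasoning
        factor-3 : ∀ M P k → M * (P ^ 2 + k) * 3 ≡ M * (3 * P ^ 2 + k * 3)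
        factor-3 = solve 3 (λ M P k → M :* (P :^ 2 :+ k) :* con 3
                                    := M :* (con 3 :* P :^ 2 :+ k :* con 3)) refl
        swap : ∀ k X → k * 3 * X ≡ k * X * 3
        swap = solve 2 (λ k X → k :* con 3 :* X := k :* X :* con 3) refl

      k⊥D′ : Coprime k D′
      k⊥D′ = coprime-∣ˡ (coprime-^ˡ 2 (Coprime.sym D′⊥δ)) (divides 3 (trans δ²≡k*3 (*-comm k 3)))
        where
        D′⊥δ : Coprime D′ δ
        D′⊥δ = coprime-+-∣ (coprime-^ˡ 2 P⊥δ) δ∣k

    δ²/3∣M : δ ^ 2 / 3 ∣ M
    δ²/3∣M = subst (_∣ M) (sym δ²/3≡k) (coprime-divisorʳ k⊥D′ (subst (k ∣_) (sym MD′≡kX) (m∣m*n X)))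
      where
      δ²/3≡k : δ ^ 2 / 3 ≡ k
      δ²/3≡k = trans (cong (_/ 3) δ²≡k*3) (m*n/n≡m k 3)

    2δ²/3∣M : 2 ∣ δ → X ≡ 2 * m → 2 * δ ^ 2 / 3 ∣ M
    2δ²/3∣M {m} 2∣δ X≡2m = subst (_∣ M) (sym 2δ²/3≡2k) (coprime-divisorʳ (coprime-*ˡ 2⊥D′ k⊥D′) 2k∣MD′)
      where
      2δ²/3≡2k : 2 * δ ^ 2 / 3 ≡ 2 * k
      2δ²/3≡2k = trans (cong (λ x → 2 * x / 3) δ²≡k*3)
                       (trans (cong (_/ 3) (sym (*-assoc 2 k 3))) (m*n/n≡m (2 * k) 3))
      2⊥D′ : Coprime 2 D′
      2⊥D′ = Coprime.sym (coprime-+-∣ (coprime-^ˡ 2 (coprime-∣ʳ P⊥δ 2∣δ)) (∣-trans 2∣δ δ∣k))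
      2k∣MD′ : 2 * k ∣ M * D′
      2k∣MD′ = subst (2 * k ∣_) (sym (trans MD′≡kX (cong (k *_) X≡2m))) (2*m∣m*[2*n] k m)

corollary2 : (η δ M f : ℕ) → 1 < η → 1 < δ → 1 < M → 1 ≤ f → gcd η δ ≡ 1 →
    (∃[ a ] ∃[ s ] (1 ≤ a × + (sumSq a M) ≡ s ℤ.* s)) →
    M * (3 * (η + δ) ^ 2 + δ ^ 2) ≡ δ ^ 2 * (3 * f ^ 2 ∸ 1) →
    (((δ % 6 ≡ 1 ⊎ δ % 6 ≡ 5) → δ ^ 2 ∣ M)
      × (δ % 6 ≡ 0 → (δ ^ 2 / 3) ∣ M))
    × (f % 2 ≡ 1 →
      ((δ % 6 ≡ 1 ⊎ δ % 6 ≡ 5) → 2 * δ ^ 2 ∣ M)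
        × (δ % 6 ≡ 0 → (2 * δ ^ 2 / 3) ∣ M))
corollary2 η δ M f _ _ _ _ gcd≡1 _ eq =
    ((λ r → δ²∣M P⊥δ eq (3⊥δ r)) , (λ r → δ²/3∣M P⊥δ eq (3∣δ r)))
  , λ f%2≡1 → case-f-odd (odd⇒3n²∸1≡2*odd {f} (coprime-% f%2≡1 (Coprime.sym (1-coprimeTo 2))))
  where
  P⊥δ : Coprime (η + δ) δ
  P⊥δ = subst (λ x → Coprime x δ) (+-comm δ η) (coprime-+ (gcd≡1⇒coprime gcd≡1))
  2⊥δ : δ % 6 ≡ 1 ⊎ δ % 6 ≡ 5 → Coprime 2 δ
  2⊥δ r = coprime-∣ˡ (coprime-6 r) (divides 3 refl)
  3⊥δ : δ % 6 ≡ 1 ⊎ δ % 6 ≡ 5 → Coprime 3 δ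
  3⊥δ r = coprime-∣ˡ (coprime-6 r) (divides 2 refl)
  2∣δ : δ % 6 ≡ 0 → 2 ∣ δ
  2∣δ r = ∣-trans (divides 3 refl) (m%n≡0⇒n∣m δ 6 r)
  3∣δ : δ % 6 ≡ 0 → 3 ∣ δ
  3∣δ r = ∣-trans (divides 2 refl) (m%n≡0⇒n∣m δ 6 r)
  case-f-odd : ∃[ m ] (3 * f ^ 2 ∸ 1 ≡ 2 * m × Coprime 2 m) →
    ((δ % 6 ≡ 1 ⊎ δ % 6 ≡ 5) → 2 * δ ^ 2 ∣ M) × (δ % 6 ≡ 0 → 2 * δ ^ 2 / 3 ∣ M)
  case-f-odd (m , X≡2m , 2⊥m) =
    (λ r → 2δ²∣M P⊥δ eq {m} (2⊥δ r) (3⊥δ r) X≡2m 2⊥m) , (λ r → 2δ²/3∣M P⊥δ eq (3∣δ r) {m} (2∣δ r) X≡2m)
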